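{- Let $n\geqslant 3$ and let $T$ be a strongly connected tournament of order $n$. Then $$\sigma(T) \leqslant \sum_{i=2}^{n} \binom{i+1}{2},$$ with equality if and only if $T$ is isomorphic to $\mathcal{B}_n$.
   Context: A tournament is a simple digraph with exactly one of the arrows $(i,j),(j,i)$ between every pair of distinct vertices. For a strongly connected digraph $G$, $|x,y|_G$ is the length of a shortest directed path from $x$ to $y$ and $\sigma(G)=\sum_{x\neq y}|x,y|_G$ over ordered pairs. The backward tournament $\mathcal{B}_n$ has vertices $v_1,\dots,v_n$ and arrows $(v_i,v_{i+1})$ for $1\leqslant i\leqslant n-1$ and $(v_i,v_j)$ for $3\leqslant i\leqslant n$, $1\leqslant j\leqslant i-2$. -}

module Defs where

open import Data.Nat using (ℕ; zero; suc; _+_; _∸_)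
open import Data.Nat.Combinatorics using (_C_)
open import Data.Bool using (Bool; true; false; if_then_else_; _∨_; _∧_; T)
open import Data.Fin using (Fin; toℕ)
open import Data.List using (List; []; _∷_; map; allFin; upTo)
open import Data.Nat.ListAction using (sum)
open import Data.Bool.ListAction using (any)
open import Relation.Binary.PropositionalEquality using (_≡_; _≢_)
open import Data.Product using (_×_; Σ; ∃)
open import Data.Sum using (_⊎_)
open import Relation.Nullary using (¬_)
open import Relation.Nullary.Decidable using (⌊_⌋)
open import Data.Fin using (_≟_)
open import Function.Bundles using (_↔_; Inverse)

Digraph : ℕ → Set
Digraph n = Fin n → Fin n → Bool

Arrow : ∀ {n} → Digraph n → Fin n → Fin n → Set
Arrow G i j = T (G i j)

record IsTournament {n : ℕ} (G : Digraph n) : Set where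
  field
    irrefl    : ∀ i → ¬ Arrow G i i
    total     : ∀ i j → i ≢ j → Arrow G i j ⊎ Arrow G j i
    antisym   : ∀ i j → Arrow G i j → ¬ Arrow G j i

data Walk {n : ℕ} (G : Digraph n) : ℕ → Fin n → Fin n → Set where
  here : ∀ {x} → Walk G 0 x x
  step : ∀ {k x y z} → Arrow G x y → Walk G k y z → Walk G (suc k) x z

StronglyConnected : ∀ {n} → Digraph n → Set
StronglyConnected {n} G = ∀ x y → ∃ λ k → Walk G k x y

reach : ∀ {n} → Digraph n → ℕ → Fin n → Fin n → Bool
reach G zero x y = ⌊ x ≟ y ⌋
reach {n} G (suc k) x y = reach G k x y ∨ any (λ z → G x z ∧ reach G k z y) (allFin n)

-- Distance |x,y|_G: least k with a walk of length ≤ k (searching k < n;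
-- in a strongly connected digraph of order n every distance is ≤ n-1).
distFrom : ∀ {n} → Digraph n → ℕ → ℕ → Fin n → Fin n → ℕ
distFrom G k zero x y = k
distFrom G k (suc fuel) x y = if reach G k x y then k else distFrom G (suc k) fuel x y

dist : ∀ {n} → Digraph n → Fin n → Fin n → ℕ
dist {n} G x y = distFrom G 0 n x y

-- σ(G): sum of |x,y|_G over ordered pairs (x ≠ y; the x = y terms are 0).
σ : ∀ {n} → Digraph n → ℕ
σ {n} G = sum (map (λ x → sum (map (λ y → dist G x y) (allFin n))) (allFin n))

-- Backward tournament B_n on v_1..v_n (vertex v_i is Fin index i-1):
-- arrows v_i → v_{i+1}, and v_i → v_j for j ≤ i-2.
-- With 0-based indices a,b: arrow a → b iff b = a+1 or b+2 ≤ a.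
backward : (n : ℕ) → Digraph n
backward n a b = ⌊ toℕ b Data.Nat.≟ suc (toℕ a) ⌋ ∨ ⌊ suc (suc (toℕ b)) Data.Nat.≤? toℕ a ⌋

Iso : ∀ {n} → Digraph n → Digraph n → Set
Iso {n} G H = Σ (Fin n ↔ Fin n) λ f →
  ∀ i j → G i j ≡ H (Inverse.to f i) (Inverse.to f j)

-- Σ_{i=2}^{n} C(i+1,2)
bound : ℕ → ℕ
bound n = sum (map (λ i → (suc (suc i) + 1) C 2) (upTo (n ∸ 1)))

module Submission where

-- The upper bound is proved by induction on n, strengthened to: strict unless two
-- vertices are at distance n − 1 (SigmaBound).  If all distances are at most 2,
-- each pair of vertices contributes at most 1 + 2.  Otherwise delete a vertex z
-- farthest from some x at distance at least 3: T − z stays strongly connected,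
-- σ(T) ≤ c(z) + σ(T − z) for the total distance c(z) from and to z, and
-- 2c(z) ≤ (n+1)n, since the distances back to z from its out-neighbours form a
-- "layered" set of values (each value above 2 preceded by the value one less),
-- whose sum is bounded in terms of its size; the same holds for in-neighbours.
-- For equality, two vertices at distance n − 1 span a shortest Hamiltonian walk,
-- which forces T ≅ B_n; conversely positions in B_n bound distances from below,
-- and these lower bounds sum to the bound.

open import Defs
open import Data.Nat using (ℕ; zero; suc; _+_; _*_; _∸_; _≤_; _<_; z≤n; s≤s; pred; _≤?_; _<?_; >-nonZero)
import Data.Nat as ℕ
open import Data.Nat.Properties hiding (_≟_)
open import Data.Nat.Induction using (<-wellFounded)
open import Data.Nat.Combinatorics using (_C_; nCk+nC[k+1]≡[n+1]C[k+1]; nC1≡n)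
open import Data.Nat.Solver using (module +-*-Solver)
open import Data.Fin using (Fin; zero; suc; toℕ; punchIn; punchOut; inject₁; _≟_)
open import Data.Fin.Properties using (pigeonhole; toℕ≤pred[n]; punchIn-punchOut; punchInᵢ≢i; punchIn-injective; any?; toℕ-injective; injective⇒≤; punchOut-injective)
open import Data.Bool using (Bool; true; false; if_then_else_; T)
open import Data.Bool.Properties using (T-∨; T-∧)
open import Data.List using (allFin; map; tabulate; upTo; _∷ʳ_; _++_; _∷_; [])
open import Data.List.Properties using (map-tabulate; map-++; upTo-∷ʳ)
open import Data.Nat.ListAction.Properties using (sum-++)
import Data.List.Relation.Unary.Any as Any
open import Data.List.Relation.Unary.Any.Properties using (any⁺; any⁻)
open import Data.List.Membership.Propositional.Properties using (∈-allFin)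
import Data.Nat.ListAction as List
open import Data.Product using (_×_; ∃; _,_; proj₁; proj₂)
open import Data.Sum using (_⊎_; inj₁; inj₂)
open import Data.Empty using (⊥-elim)
open import Data.Unit using (tt)
open import Function using (_∘_)
open import Function.Bundles using (Equivalence; Inverse; _↔_; mk↔ₛ′; _⇔_; mk⇔)
open import Induction.WellFounded using (Acc; acc)
open import Relation.Nullary using (¬_; yes; no)
open import Relation.Nullary.Decidable using (toWitness; fromWitness; T?; ⌊_⌋)
open import Relation.Binary.PropositionalEquality
open import Relation.Binary.Definitions using (tri<; tri≈; tri>)

open import Algebra.Properties.CommutativeMonoid.Sum +-0-commutativeMonoid
  using (sum; sum-syntax; sum-remove; sum-cong-≗; sum-replicate-zero; ∑-distrib-+; ∑-comm; sum-permute)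

sum-mono : ∀ {n} {f g : Fin n → ℕ} → (∀ i → f i ≤ g i) → sum f ≤ sum g
sum-mono {zero}  le = z≤n
sum-mono {suc n} le = +-mono-≤ (le zero) (sum-mono (le ∘ suc))

term≤sum : ∀ {n} (f : Fin n → ℕ) i → f i ≤ sum f
term≤sum f zero    = m≤m+n _ _
term≤sum f (suc i) = ≤-trans (term≤sum (f ∘ suc) i) (m≤n+m _ _)

sum-const : ∀ n c → ∑[ i < n ] c ≡ n * c
sum-const zero    c = refl
sum-const (suc n) c = cong (c +_) (sum-const n c)

listSum-allFin : ∀ {n} (f : Fin n → ℕ) → List.sum (map f (allFin n)) ≡ sum f
listSum-allFin {n} f = trans (cong List.sum (map-tabulate (λ i → i) f)) (tabulated f)
  where
  tabulated : ∀ {n} (f : Fin n → ℕ) → List.sum (tabulate f) ≡ sum f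
  tabulated {zero}  f = refl
  tabulated {suc n} f = cong (f zero +_) (tabulated (f ∘ suc))

σ-as-sum : ∀ {n} (G : Digraph n) → σ G ≡ ∑[ x < n ] ∑[ y < n ] dist G x y
σ-as-sum {n} G = trans (listSum-allFin (λ x → List.sum (map (dist G x) (allFin n))))
  (sum-cong-≗ (λ x → listSum-allFin (dist G x)))

-- Replacing a stretch from position i to j of a walk of length k by a walk of
-- length m, with i + m < j, yields a shorter walk.
shortcut-shorter : ∀ {k} m (i j : Fin (suc k)) → toℕ i + m < toℕ j → toℕ i + (m + (k ∸ toℕ j)) < k
shortcut-shorter {k} m i j lt = begin-strict
  toℕ i + (m + (k ∸ toℕ j)) ≡⟨ +-assoc (toℕ i) m _ ⟨
  toℕ i + m + (k ∸ toℕ j)   <⟨ +-monoˡ-< (k ∸ toℕ j) lt ⟩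
  toℕ j + (k ∸ toℕ j)       ≡⟨ m+[n∸m]≡n (toℕ≤pred[n] j) ⟩
  k                         ∎
  where open ≤-Reasoning

module _ {n : ℕ} {G : Digraph n} where

  infixr 5 _++ᵂ_
  _++ᵂ_ : ∀ {k m x y z} → Walk G k x y → Walk G m y z → Walk G (k + m) x z
  here     ++ᵂ w = w
  step a v ++ᵂ w = step a (v ++ᵂ w)

  _▷_ : ∀ {k x y z} → Walk G k x y → Arrow G y z → Walk G (suc k) x z
  here     ▷ a = step a here
  step b w ▷ a = step b (w ▷ a)

  unsnoc : ∀ {k x z} → Walk G (suc k) x z → ∃ λ y → Walk G k x y × Arrow G y z
  unsnoc (step a here) = _ , here , a
  unsnoc (step a (step b w)) with unsnoc (step b w)
  ... | y , w′ , c = y , step a w′ , c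

  vertex : ∀ {k x y} → Walk G k x y → Fin (suc k) → Fin n
  vertex {x = x} w zero = x
  vertex (step a w) (suc i) = vertex w i

  prefix : ∀ {k x y} (w : Walk G k x y) (i : Fin (suc k)) → Walk G (toℕ i) x (vertex w i)
  prefix w zero = here
  prefix (step a w) (suc i) = step a (prefix w i)

  suffix : ∀ {k x y} (w : Walk G k x y) (i : Fin (suc k)) → Walk G (k ∸ toℕ i) (vertex w i) y
  suffix w zero = w
  suffix (step a w) (suc i) = suffix w i

  vertex-arrow : ∀ {k x y} (w : Walk G k x y) (i : Fin k) → Arrow G (vertex w (inject₁ i)) (vertex w (suc i))
  vertex-arrow (step a w) zero = a
  vertex-arrow (step a w) (suc i) = vertex-arrow w i

  shortcut : ∀ {k m x y} (w : Walk G k x y) (i j : Fin (suc k)) → Walk G m (vertex w i) (vertex w j) →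
             Walk G (toℕ i + (m + (k ∸ toℕ j))) x y
  shortcut w i j u = prefix w i ++ᵂ (u ++ᵂ suffix w j)

  remove-cycle : ∀ {k x y} (w : Walk G k x y) (i j : Fin (suc k)) → toℕ i < toℕ j → vertex w i ≡ vertex w j →
                 ∃ λ m → m < k × Walk G m x y
  remove-cycle w i j i<j eq =
    _ , shortcut-shorter 0 i j (subst (_< toℕ j) (sym (+-identityʳ (toℕ i))) i<j) ,
    shortcut w i j (subst (λ v → Walk G 0 (vertex w i) v) eq here)

  shorten : ∀ {k x y} → Walk G k x y → ∃ λ m → m ≤ k × m < n × Walk G m x y
  shorten w = go w (<-wellFounded _)
    where
    go : ∀ {k x y} → Walk G k x y → Acc _<_ k → ∃ λ m → m ≤ k × m < n × Walk G m x y
    go {k} w (acc smaller) with k <? n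
    ... | yes k<n = k , ≤-refl , k<n , w
    ... | no k≮n with pigeonhole (≰⇒> k≮n) (vertex w)
    ...   | i , j , i<j , eq with remove-cycle w i j i<j eq
    ...     | m , m<k , w′ with go w′ (smaller m<k)
    ...       | l , l≤m , l<n , w″ = l , ≤-trans l≤m (<⇒≤ m<k) , l<n , w″

module Reachability {n : ℕ} (G : Digraph n) where

  reach-complete : ∀ k {j x y} → Walk G j x y → j ≤ k → T (reach G k x y)
  reach-complete zero    here z≤n = fromWitness refl
  reach-complete (suc k) w j≤1+k with m≤n⇒m<n∨m≡n j≤1+k
  ... | inj₁ j≤k = Equivalence.from T-∨ (inj₁ (reach-complete k w (≤-pred j≤k)))
  ... | inj₂ refl with w
  ...   | step {y = z} a w′ = Equivalence.from T-∨ (inj₂ (any⁺ _ (Any.map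
            (λ { refl → Equivalence.from T-∧ (a , reach-complete k w′ ≤-refl) }) (∈-allFin z))))

  reach-sound : ∀ k {x y} → T (reach G k x y) → ∃ λ j → j ≤ k × Walk G j x y
  reach-sound zero {x} {y} r with toWitness {a? = x ≟ y} r
  ... | refl = 0 , z≤n , here
  reach-sound (suc k) r with Equivalence.to T-∨ r
  ... | inj₁ r′ = let j , j≤k , w = reach-sound k r′ in j , m≤n⇒m≤1+n j≤k , w
  ... | inj₂ r′ with Any.satisfied (any⁻ _ (allFin n) r′)
  ...   | z , p with Equivalence.to T-∧ p
  ...     | a , r″ = let j , j≤k , w = reach-sound k r″ in suc j , s≤s j≤k , step a w

  distFrom-≤ : ∀ fuel k j {x y} → T (reach G j x y) → k ≤ j → j < k + fuel → distFrom G k fuel x y ≤ j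
  distFrom-≤ zero k j r k≤j j<k = ⊥-elim (<⇒≱ (subst (j <_) (+-identityʳ k) j<k) k≤j)
  distFrom-≤ (suc fuel) k j {x} {y} r k≤j j< with reach G k x y in e
  ... | true = k≤j
  ... | false with m≤n⇒m<n∨m≡n k≤j
  ...   | inj₁ k<j = distFrom-≤ fuel (suc k) j r k<j (subst (j <_) (+-suc k fuel) j<)
  ...   | inj₂ refl = ⊥-elim (subst T e r)

  distFrom-reach : ∀ fuel k {x y} → distFrom G k fuel x y < k + fuel → T (reach G (distFrom G k fuel x y) x y)
  distFrom-reach zero k lt = ⊥-elim (<-irrefl (sym (+-identityʳ k)) lt)
  distFrom-reach (suc fuel) k {x} {y} lt with reach G k x y in e
  ... | true = subst T (sym e) tt
  ... | false = distFrom-reach fuel (suc k) (subst (distFrom G (suc k) fuel x y <_) (+-suc k fuel) lt)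

  dist-< : ∀ {k x y} → Walk G k x y → dist G x y < n
  dist-< w with shorten w
  ... | m , _ , m<n , w′ = ≤-<-trans (distFrom-≤ n 0 m (reach-complete m w′ ≤-refl) z≤n m<n) m<n

  dist-≤ : ∀ {k x y} → Walk G k x y → dist G x y ≤ k
  dist-≤ w with shorten w
  ... | m , m≤k , m<n , w′ = ≤-trans (distFrom-≤ n 0 m (reach-complete m w′ ≤-refl) z≤n m<n) m≤k

  dist-self : ∀ x → dist G x x ≡ 0
  dist-self x = n≤0⇒n≡0 (dist-≤ here)

  geodesic : ∀ {k x y} → Walk G k x y → Walk G (dist G x y) x y
  geodesic {x = x} {y} w with reach-sound (dist G x y) (distFrom-reach n 0 (dist-< w))
  ... | j , j≤ , w′ = subst (λ j → Walk G j x y) (≤-antisym j≤ (dist-≤ w′)) w′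

open Reachability

module Distance {n : ℕ} (G : Digraph n) (sc : StronglyConnected G) where

  d : Fin n → Fin n → ℕ
  d = dist G

  shortest : ∀ x y → Walk G (d x y) x y
  shortest x y = geodesic G (proj₂ (sc x y))

  d<n : ∀ x y → d x y < n
  d<n x y = dist-< G (proj₂ (sc x y))

  d-self : ∀ x → d x x ≡ 0
  d-self = dist-self G

  d≡0 : ∀ {x y} → d x y ≡ 0 → x ≡ y
  d≡0 {x} {y} e with subst (λ k → Walk G k x y) e (shortest x y)
  ... | here = refl

  d-positive : ∀ {x y} → x ≢ y → 1 ≤ d x y
  d-positive x≢y = n≢0⇒n>0 (x≢y ∘ d≡0)

  d-arrow : ∀ {x y} → x ≢ y → Arrow G x y → d x y ≡ 1
  d-arrow x≢y a = ≤-antisym (dist-≤ G (step a here)) (d-positive x≢y)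

  d≡1 : ∀ {x y} → d x y ≡ 1 → Arrow G x y
  d≡1 {x} {y} e with subst (λ k → Walk G k x y) e (shortest x y)
  ... | step a here = a

  d-≥2 : ∀ {x y} → x ≢ y → ¬ Arrow G x y → 2 ≤ d x y
  d-≥2 {x} {y} x≢y ¬a with d x y in e
  ... | zero        = ⊥-elim (x≢y (d≡0 e))
  ... | suc zero    = ⊥-elim (¬a (d≡1 e))
  ... | suc (suc _) = s≤s (s≤s z≤n)

  d-▷ : ∀ {x y z} → Arrow G y z → d x z ≤ suc (d x y)
  d-▷ {x} {y} a = dist-≤ G (shortest x y ▷ a)

  d-◁ : ∀ {x y z} → Arrow G x y → d x z ≤ suc (d y z)
  d-◁ {y = y} {z} a = dist-≤ G (step a (shortest y z))

  shortest⁺ : ∀ {x y} → 1 ≤ d x y → Walk G (suc (pred (d x y))) x y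
  shortest⁺ {x} {y} 1≤d = subst (λ k → Walk G k x y) (sym (suc-pred (d x y) ⦃ >-nonZero 1≤d ⦄)) (shortest x y)

  last-step : ∀ {x y} → 1 ≤ d x y → ∃ λ u → Arrow G u y × suc (d x u) ≡ d x y
  last-step {x} {y} 1≤d with unsnoc (shortest⁺ 1≤d)
  ... | u , w , a = u , a , ≤-antisym
        (≤-trans (s≤s (dist-≤ G w)) (≤-reflexive (suc-pred (d x y) ⦃ >-nonZero 1≤d ⦄))) (d-▷ a)

  first-step : ∀ {x y} → 1 ≤ d x y → ∃ λ u → Arrow G x u × suc (d u y) ≡ d x y
  first-step {x} {y} 1≤d with shortest⁺ 1≤d
  ... | step {y = u} a w = u , a , ≤-antisym
        (≤-trans (s≤s (dist-≤ G w)) (≤-reflexive (suc-pred (d x y) ⦃ >-nonZero 1≤d ⦄))) (d-◁ a)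

count : ∀ {N} → (Fin N → Bool) → ℕ
count {N} P = ∑[ y < N ] (if P y then 1 else 0)

sumOver : ∀ {N} → (Fin N → Bool) → (Fin N → ℕ) → ℕ
sumOver {N} P g = ∑[ y < N ] (if P y then g y else 0)

if-T : ∀ {b} {x y : ℕ} → T b → (if b then x else y) ≡ x
if-T {true} _ = refl

if-¬T : ∀ {b} {x y : ℕ} → ¬ T b → (if b then x else y) ≡ y
if-¬T {false} _ = refl
if-¬T {true}  ¬t = ⊥-elim (¬t tt)

≡true⇒T : ∀ {b} → b ≡ true → T b
≡true⇒T refl = tt

≡false⇒¬T : ∀ {b} → b ≡ false → ¬ T b
≡false⇒¬T refl ()

T⇒≡true : ∀ {b} → T b → b ≡ true
T⇒≡true {true} _ = refl

¬T⇒≡false : ∀ {b} → ¬ T b → b ≡ false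
¬T⇒≡false {false} _  = refl
¬T⇒≡false {true}  ¬t = ⊥-elim (¬t tt)

nonempty⇒count : ∀ {N} {P : Fin N → Bool} → (∃ λ y → T (P y)) → 1 ≤ count P
nonempty⇒count {P = P} (y , py) = subst (_≤ count P) (if-T py) (term≤sum (λ y → if P y then 1 else 0) y)

-- The
-- distances to a vertex from its out-neighbours in a tournament are layered.
record Layered {N : ℕ} (P : Fin N → Bool) (g : Fin N → ℕ) : Set where
  field
    two≤  : ∀ y → T (P y) → 2 ≤ g y
    below : ∀ y → T (P y) → 3 ≤ g y → ∃ λ u → T (P u) × suc (g u) ≡ g y

maximum : ∀ {N} (P : Fin N → Bool) (g : Fin N → ℕ) →
          (∀ y → ¬ T (P y)) ⊎ (∃ λ m → T (P m) × ∀ y → T (P y) → g y ≤ g m)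
maximum {zero}  P g = inj₁ λ ()
maximum {suc N} P g with maximum (P ∘ suc) (g ∘ suc) | T? (P zero)
... | inj₁ none | no ¬p₀ = inj₁ λ { zero → ¬p₀ ; (suc y) → none y }
... | inj₁ none | yes p₀ = inj₂ (zero , p₀ , λ { zero _ → ≤-refl ; (suc y) py → ⊥-elim (none y py) })
... | inj₂ (m , pm , max) | no ¬p₀ = inj₂ (suc m , pm , λ { zero p → ⊥-elim (¬p₀ p) ; (suc y) → max y })
... | inj₂ (m , pm , max) | yes p₀ with g zero ≤? g (suc m)
...   | yes le = inj₂ (suc m , pm , λ { zero _ → le ; (suc y) → max y })
...   | no  gt = inj₂ (zero , p₀ , λ { zero _ → ≤-refl ; (suc y) py → ≤-trans (max y py) (<⇒≤ (≰⇒> gt)) })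

sumOver-empty : ∀ {N} {P : Fin N → Bool} (g : Fin N → ℕ) → (∀ y → ¬ T (P y)) → sumOver P g ≡ 0
sumOver-empty {N} g none = trans (sum-cong-≗ (λ y → if-¬T (none y))) (sum-replicate-zero N)

module RemoveMaximum {N : ℕ} {P : Fin (suc N) → Bool} {g : Fin (suc N) → ℕ} (layered : Layered P g)
                     (m : Fin (suc N)) (Pm : T (P m)) (max : ∀ y → T (P y) → g y ≤ g m) where
  open Layered layered

  P′ : Fin N → Bool
  P′ = P ∘ punchIn m

  g′ : Fin N → ℕ
  g′ = g ∘ punchIn m

  count-split : count P ≡ suc (count P′)
  count-split = trans (sum-remove {i = m} (λ y → if P y then 1 else 0)) (cong (_+ count P′) (if-T Pm))

  sumOver-split : sumOver P g ≡ g m + sumOver P′ g′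
  sumOver-split = trans (sum-remove {i = m} (λ y → if P y then g y else 0)) (cong (_+ sumOver P′ g′) (if-T Pm))

  survives : ∀ u → T (P u) → suc (g u) ≤ g m → ∃ λ u′ → T (P′ u′) × g′ u′ ≡ g u
  survives u pu gu<gm = punchOut m≢u , subst (T ∘ P) (sym eq) pu , cong g eq
    where
    m≢u : m ≢ u
    m≢u refl = <-irrefl refl gu<gm
    eq : punchIn m (punchOut m≢u) ≡ u
    eq = punchIn-punchOut m≢u

  layered′ : Layered P′ g′
  layered′ = record
    { two≤  = λ y → two≤ (punchIn m y)
    ; below = λ y py g≥3 →
        let u , pu , e = below (punchIn m y) py g≥3
            u′ , pu′ , e′ = survives u pu (≤-trans (≤-reflexive e) (max _ py))
        in u′ , pu′ , trans (cong suc e′) e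
    }

-- One removal step in arithmetic form: a value g with g + e ≤ q + 2 on top of a
-- subset of size q whose values satisfy the bound below.
layer-step : ∀ q t g e → 2 * t ≤ q * q + 3 * q → g + e ≤ 2 + q →
             2 * (g + t) + 2 * e ≤ suc q * suc q + 3 * suc q
layer-step q t g e ih g+e≤ = begin
  2 * (g + t) + 2 * e            ≡⟨ solve 3 (λ g t e → con 2 :* (g :+ t) :+ con 2 :* e
                                              := con 2 :* (g :+ e) :+ con 2 :* t) refl g t e ⟩
  2 * (g + e) + 2 * t            ≤⟨ +-mono-≤ (*-monoʳ-≤ 2 g+e≤) ih ⟩
  2 * (2 + q) + (q * q + 3 * q)  ≡⟨ solve 1 (λ q → con 2 :* (con 2 :+ q) :+ (q :* q :+ con 3 :* q)
                                              := (con 1 :+ q) :* (con 1 :+ q) :+ con 3 :* (con 1 :+ q)) refl q ⟩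
  suc q * suc q + 3 * suc q      ∎
  where
  open ≤-Reasoning
  open +-*-Solver

-- A layered subset of size q has values at most q + 1, and summing to at most
-- 2 + 3 + ⋯ + (q + 1), i.e. twice the total is at most q² + 3q.
layered-bound : ∀ {N} {P : Fin N → Bool} {g : Fin N → ℕ} → Layered P g →
                2 * sumOver P g ≤ count P * count P + 3 * count P × (∀ y → T (P y) → g y ≤ suc (count P))
layered-bound {zero} _ = z≤n , λ ()
layered-bound {suc N} {P} {g} layered with maximum P g
... | inj₁ none = subst (λ t → 2 * t ≤ count P * count P + 3 * count P) (sym (sumOver-empty g none)) z≤n , λ y py → ⊥-elim (none y py)
... | inj₂ (m , Pm , max) = sum-bound , λ y py → ≤-trans (max y py) (subst (λ c → g m ≤ suc c) (sym count-split) top)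
  where
  open RemoveMaximum layered m Pm max
  open Layered layered
  q′ : ℕ
  q′ = count P′
  ih = layered-bound layered′
  -- The maximum is preceded by a chain of values in the rest of the subset.
  top : g m ≤ 2 + q′
  top with g m ≤? 2
  ... | yes ≤2 = ≤-trans ≤2 (m≤m+n 2 q′)
  ... | no  >2 = let u , pu , e    = below m Pm (≰⇒> >2)
                     u′ , pu′ , e′ = survives u pu (≤-reflexive e)
                 in subst (_≤ 2 + q′) e (s≤s (subst (_≤ suc q′) e′ (proj₂ ih u′ pu′)))
  sum-bound : 2 * sumOver P g ≤ count P * count P + 3 * count P
  sum-bound = begin
    2 * sumOver P g                    ≡⟨ cong (2 *_) sumOver-split ⟩
    2 * (g m + sumOver P′ g′)          ≤⟨ m≤m+n _ (2 * 0) ⟩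
    2 * (g m + sumOver P′ g′) + 2 * 0  ≤⟨ layer-step q′ _ (g m) 0 (proj₁ ih) (subst (_≤ 2 + q′) (sym (+-identityʳ (g m))) top) ⟩
    suc q′ * suc q′ + 3 * suc q′     ≡⟨ cong (λ c → c * c + 3 * c) count-split ⟨
    count P * count P + 3 * count P  ∎
    where open ≤-Reasoning

layered-bound-strict : ∀ {N} {P : Fin N → Bool} {g : Fin N → ℕ} → Layered P g → (∃ λ y → T (P y)) →
                       (∀ y → T (P y) → g y ≤ count P) → 2 * sumOver P g + 2 ≤ count P * count P + 3 * count P
layered-bound-strict {suc N} {P} {g} layered (y , py) small with maximum P g
... | inj₁ none = ⊥-elim (none y py)
... | inj₂ (m , Pm , max) = begin
    2 * sumOver P g + 2                ≡⟨ cong (λ t → 2 * t + 2) sumOver-split ⟩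
    2 * (g m + sumOver P′ g′) + 2 * 1  ≤⟨ layer-step (count P′) _ (g m) 1 (proj₁ (layered-bound layered′)) top ⟩
    suc (count P′) * suc (count P′) + 3 * suc (count P′) ≡⟨ cong (λ c → c * c + 3 * c) count-split ⟨
    count P * count P + 3 * count P  ∎
  where
  open RemoveMaximum layered m Pm max
  open ≤-Reasoning
  top : g m + 1 ≤ 2 + count P′
  top = subst (_≤ 2 + count P′) (+-comm 1 (g m)) (s≤s (subst (g m ≤_) count-split (small m Pm)))

module TournamentDistance {n : ℕ} (G : Digraph n) (tour : IsTournament G) (sc : StronglyConnected G) where
  open IsTournament tour public
  open Distance G sc public

  arrow⇒≢ : ∀ {x y} → Arrow G x y → x ≢ y
  arrow⇒≢ {x} a refl = irrefl x a

  arrow⇒d≡1 : ∀ {x y} → Arrow G x y → d x y ≡ 1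
  arrow⇒d≡1 a = d-arrow (arrow⇒≢ a) a

  reverse : ∀ {x y} → x ≢ y → ¬ Arrow G x y → Arrow G y x
  reverse {x} {y} x≢y ¬a with total x y x≢y
  ... | inj₁ a = ⊥-elim (¬a a)
  ... | inj₂ a = a

  far⇒arrow : ∀ {x y} → 2 ≤ d x y → Arrow G y x
  far⇒arrow {x} {y} 2≤d = reverse x≢y (λ a → <-irrefl (sym (arrow⇒d≡1 a)) 2≤d)
    where
    x≢y : x ≢ y
    x≢y refl = <-irrefl (sym (d-self x)) (≤-trans (s≤s z≤n) 2≤d)

  below-n : ∀ {x y} → d x y ≢ pred n → d x y < pred n
  below-n {x} {y} ≢ = ≤∧≢⇒< (<⇒≤pred (d<n x y)) ≢

  pair : ∀ {x y} → x ≢ y → (d x y ≡ 1) ⊎ (d y x ≡ 1)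
  pair {x} {y} x≢y with total x y x≢y
  ... | inj₁ a = inj₁ (arrow⇒d≡1 a)
  ... | inj₂ a = inj₂ (arrow⇒d≡1 a)

contribution : ∀ {n} → Digraph n → Fin n → ℕ
contribution {n} G z = ∑[ y < n ] (dist G z y + dist G y z)

positive : ∀ {m} → 1 ≤ m → ∃ λ a → m ≡ suc a
positive {suc a} _ = a , refl

contribution-arith : ∀ a b tO tI eO eI →
                     2 * tO + 2 * eO ≤ suc a * suc a + 3 * suc a → 2 * tI + 2 * eI ≤ suc b * suc b + 3 * suc b →
                     2 * ((suc a + suc b) + (tO + tI)) + 2 * (eO + eI + a * b) ≤ suc (suc (suc a + suc b)) * suc (suc a + suc b)
contribution-arith a b tO tI eO eI out-bound in-bound = begin
  2 * ((suc a + suc b) + (tO + tI)) + 2 * (eO + eI + a * b)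
    ≡⟨ solve 7 (λ a b tO tI eO eI ab →
         con 2 :* ((con 1 :+ a :+ (con 1 :+ b)) :+ (tO :+ tI)) :+ con 2 :* (eO :+ eI :+ ab)
         := (con 2 :* tO :+ con 2 :* eO) :+ (con 2 :* tI :+ con 2 :* eI) :+ (con 2 :* (con 1 :+ a :+ (con 1 :+ b)) :+ con 2 :* ab))
         refl a b tO tI eO eI (a * b) ⟩
  (2 * tO + 2 * eO) + (2 * tI + 2 * eI) + (2 * (suc a + suc b) + 2 * (a * b))
    ≤⟨ +-monoˡ-≤ _ (+-mono-≤ out-bound in-bound) ⟩
  (suc a * suc a + 3 * suc a) + (suc b * suc b + 3 * suc b) + (2 * (suc a + suc b) + 2 * (a * b))
    ≡⟨ solve 2 (λ a b →
         ((con 1 :+ a) :* (con 1 :+ a) :+ con 3 :* (con 1 :+ a)) :+ ((con 1 :+ b) :* (con 1 :+ b) :+ con 3 :* (con 1 :+ b))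
           :+ (con 2 :* (con 1 :+ a :+ (con 1 :+ b)) :+ con 2 :* (a :* b))
         := (con 2 :+ (con 1 :+ a :+ (con 1 :+ b))) :* (con 1 :+ (con 1 :+ a :+ (con 1 :+ b)))) refl a b ⟩
  suc (suc (suc a + suc b)) * suc (suc a + suc b) ∎
  where
  open ≤-Reasoning
  open +-*-Solver

-- The contribution of a vertex z of a strongly connected tournament on N = n + 1
-- vertices is at most (N + 1) N / 2: the in- and out-neighbours of z form
-- layered subsets for the distances to resp. from z.
module Contribution {n : ℕ} (G : Digraph (suc n)) (tour : IsTournament G) (sc : StronglyConnected G)
                    (z : Fin (suc n)) where
  open TournamentDistance G tour sc

  Out In : Fin (suc n) → Bool
  Out y = G z y
  In  y = G y z

  out-layered : Layered Out (λ y → d y z)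
  out-layered = record
    { two≤  = λ y a → d-≥2 (arrow⇒≢ a ∘ sym) (antisym z y a)
    ; below = λ y _ d≥3 → let u , _ , e = first-step (≤-trans (s≤s z≤n) d≥3)
                           in u , far⇒arrow (≤-pred (subst (3 ≤_) (sym e) d≥3)) , e
    }

  in-layered : Layered In (λ y → d z y)
  in-layered = record
    { two≤  = λ y a → d-≥2 (arrow⇒≢ a ∘ sym) (antisym y z a)
    ; below = λ y _ d≥3 → let u , _ , e = last-step (≤-trans (s≤s z≤n) d≥3)
                           in u , far⇒arrow (≤-pred (subst (3 ≤_) (sym e) d≥3)) , e
    }

  ind : Bool → ℕ
  ind b = if b then 1 else 0

  no-arrows⇒≡ : ∀ y → ¬ T (Out y) → ¬ T (In y) → y ≡ z
  no-arrows⇒≡ y ¬out ¬in with y ≟ z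
  ... | yes y≡z = y≡z
  ... | no  y≢z = ⊥-elim (¬in (reverse (y≢z ∘ sym) ¬out))

  one-side : ∀ y → y ≢ z → ind (Out y) + ind (In y) ≡ 1
  one-side y y≢z with G z y in out | G y z in inn
  ... | true  | true  = ⊥-elim (antisym z y (≡true⇒T out) (≡true⇒T inn))
  ... | true  | false = refl
  ... | false | true  = refl
  ... | false | false = ⊥-elim (y≢z (no-arrows⇒≡ y (≡false⇒¬T out) (≡false⇒¬T inn)))

  neighbour-count : count Out + count In ≡ n
  neighbour-count = begin
    count Out + count In                                    ≡⟨ ∑-distrib-+ (ind ∘ Out) (ind ∘ In) ⟨
    ∑[ y < suc n ] (ind (Out y) + ind (In y))               ≡⟨ sum-remove {i = z} (λ y → ind (Out y) + ind (In y)) ⟩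
    ind (Out z) + ind (In z) + ∑[ i < n ] (ind (Out (punchIn z i)) + ind (In (punchIn z i)))
      ≡⟨ cong₂ _+_ (cong₂ _+_ (if-¬T (irrefl z)) (if-¬T (irrefl z)))
                   (sum-cong-≗ (λ i → one-side (punchIn z i) (punchInᵢ≢i z i))) ⟩
    ∑[ i < n ] 1                                            ≡⟨ sum-const n 1 ⟩
    n * 1                                                   ≡⟨ *-identityʳ n ⟩
    n                                                       ∎
    where open ≡-Reasoning

  out-part in-part : Fin (suc n) → ℕ
  out-part y = if Out y then d y z else 0
  in-part  y = if In y then d z y else 0

  -- To an out-neighbour the distance is 1, from an in-neighbour as well.
  split-pointwise : ∀ y → d z y + d y z ≡ (ind (Out y) + ind (In y)) + (out-part y + in-part y)
  split-pointwise y with G z y in out | G y z in inn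
  ... | true  | true  = ⊥-elim (antisym z y (≡true⇒T out) (≡true⇒T inn))
  ... | true  | false = cong₂ _+_ (arrow⇒d≡1 (≡true⇒T out)) (sym (+-identityʳ (d y z)))
  ... | false | true  = trans (cong (d z y +_) (arrow⇒d≡1 (≡true⇒T inn))) (+-comm (d z y) 1)
  ... | false | false = cong₂ _+_ (trans (cong (d z) y≡z) (d-self z)) (trans (cong (λ v → d v z) y≡z) (d-self z))
    where
    y≡z : y ≡ z
    y≡z = no-arrows⇒≡ y (≡false⇒¬T out) (≡false⇒¬T inn)

  contribution-split : contribution G z ≡ n + (sumOver Out (λ y → d y z) + sumOver In (λ y → d z y))
  contribution-split = begin
    contribution G z                                         ≡⟨ sum-cong-≗ split-pointwise ⟩
    ∑[ y < suc n ] ((ind (Out y) + ind (In y)) + (out-part y + in-part y))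
      ≡⟨ ∑-distrib-+ (λ y → ind (Out y) + ind (In y)) (λ y → out-part y + in-part y) ⟩
    ∑[ y < suc n ] (ind (Out y) + ind (In y)) + ∑[ y < suc n ] (out-part y + in-part y)
      ≡⟨ cong₂ _+_ (trans (∑-distrib-+ (ind ∘ Out) (ind ∘ In)) neighbour-count) (∑-distrib-+ out-part in-part) ⟩
    n + (sumOver Out (λ y → d y z) + sumOver In (λ y → d z y))   ∎
    where open ≡-Reasoning

  -- Given a second vertex w, both sides of z are nonempty and the bound follows.
  module Bound (w : Fin (suc n)) (w≢z : w ≢ z) where
    out-nonempty : ∃ λ y → T (Out y)
    out-nonempty = let u , a , _ = first-step (d-positive (w≢z ∘ sym)) in u , a

    in-nonempty : ∃ λ y → T (In y)
    in-nonempty = let u , a , _ = last-step (d-positive w≢z) in u , a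

    -- With a + 1 out- and b + 1 in-neighbours, side bounds with slack 2eO and 2eI
    -- give the contribution bound with slack 2(eO + eI + ab).
    combine : ∀ eO eI a b → count Out ≡ suc a → count In ≡ suc b →
              2 * sumOver Out (λ y → d y z) + 2 * eO ≤ count Out * count Out + 3 * count Out →
              2 * sumOver In (λ y → d z y) + 2 * eI ≤ count In * count In + 3 * count In →
              2 * contribution G z + 2 * (eO + eI + a * b) ≤ suc (suc n) * suc n
    combine eO eI a b ea eb out-bound in-bound = begin
      2 * contribution G z + 2 * (eO + eI + a * b)         ≡⟨ cong (λ c → 2 * c + 2 * (eO + eI + a * b)) contribution-split ⟩
      2 * (n + (tO + tI)) + 2 * (eO + eI + a * b)          ≡⟨ cong (λ m → 2 * (m + (tO + tI)) + 2 * (eO + eI + a * b)) n≡ ⟨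
      2 * ((suc a + suc b) + (tO + tI)) + 2 * (eO + eI + a * b)
        ≤⟨ contribution-arith a b tO tI eO eI (subst (λ c → 2 * tO + 2 * eO ≤ c * c + 3 * c) ea out-bound)
                                              (subst (λ c → 2 * tI + 2 * eI ≤ c * c + 3 * c) eb in-bound) ⟩
      suc (suc (suc a + suc b)) * suc (suc a + suc b)      ≡⟨ cong (λ m → suc (suc m) * suc m) n≡ ⟩
      suc (suc n) * suc n                                  ∎
      where
      open ≤-Reasoning
      tO = sumOver Out (λ y → d y z)
      tI = sumOver In (λ y → d z y)
      n≡ : suc a + suc b ≡ n
      n≡ = trans (cong₂ _+_ (sym ea) (sym eb)) neighbour-count

    weak : ∀ {N} {P : Fin N → Bool} {g} → Layered P g → 2 * sumOver P g + 2 * 0 ≤ count P * count P + 3 * count P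
    weak {P = P} {g} layered = subst (_≤ count P * count P + 3 * count P) (sym (+-identityʳ (2 * sumOver P g))) (proj₁ (layered-bound layered))

    contribution-≤ : 2 * contribution G z ≤ suc (suc n) * suc n
    contribution-≤ =
      let a , ea = positive (nonempty⇒count out-nonempty)
          b , eb = positive (nonempty⇒count in-nonempty)
      in ≤-trans (m≤m+n _ _) (combine 0 0 a b ea eb (weak out-layered) (weak in-layered))

    -- No distance from or to z reaches n: then one side is small and its bound strict,
    -- or both sides have at least two elements.
    contribution-< : (∀ y → d z y ≢ n) → (∀ y → d y z ≢ n) → 2 * contribution G z + 2 ≤ suc (suc n) * suc n
    contribution-< no-out no-in with positive (nonempty⇒count out-nonempty) | positive (nonempty⇒count in-nonempty)
    ... | suc a , ea | suc b , eb =
      ≤-trans (+-monoʳ-≤ _ (*-monoʳ-≤ 2 (s≤s z≤n))) (combine 0 0 (suc a) (suc b) ea eb (weak out-layered) (weak in-layered))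
    ... | zero , ea | b , eb =
      combine 0 1 0 b ea eb (weak out-layered) (layered-bound-strict in-layered in-nonempty in-small)
      where
      in-small : ∀ y → T (In y) → d z y ≤ count In
      in-small y _ = subst (d z y ≤_) (sym eb) (<⇒≤pred (subst (d z y <_)
                       (trans (sym neighbour-count) (cong₂ _+_ ea eb)) (below-n (no-out y))))
    ... | suc a , ea | zero , eb =
      subst (λ t → 2 * contribution G z + 2 * (1 + 0 + t) ≤ suc (suc n) * suc n) (*-zeroʳ (suc a))
        (combine 1 0 (suc a) 0 ea eb (layered-bound-strict out-layered out-nonempty out-small) (weak in-layered))
      where
      out-small : ∀ y → T (Out y) → d y z ≤ count Out
      out-small y _ = subst (d y z ≤_) (sym ea) (<⇒≤pred (subst (d y z <_)
                        (trans (sym neighbour-count) (trans (cong₂ _+_ ea eb) (+-comm (suc (suc a)) 1))) (below-n (no-in y))))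

delete : ∀ {n} → Digraph (suc n) → Fin (suc n) → Digraph n
delete G z i j = G (punchIn z i) (punchIn z j)

delete-tournament : ∀ {n} {G : Digraph (suc n)} z → IsTournament G → IsTournament (delete G z)
delete-tournament z tour = record
  { irrefl  = λ i → irrefl (punchIn z i)
  ; total   = λ i j i≢j → total (punchIn z i) (punchIn z j) (i≢j ∘ punchIn-injective z i j)
  ; antisym = λ i j → antisym (punchIn z i) (punchIn z j)
  }
  where open IsTournament tour

lift-walk : ∀ {n} {G : Digraph (suc n)} {z k i j} → Walk (delete G z) k i j → Walk G k (punchIn z i) (punchIn z j)
lift-walk here       = here
lift-walk (step a w) = step a (lift-walk w)

σ-split : ∀ {n} (G : Digraph (suc n)) z →
          σ G ≡ contribution G z + ∑[ i < n ] ∑[ j < n ] dist G (punchIn z i) (punchIn z j)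
σ-split {n} G z = begin
  σ G                                                     ≡⟨ σ-as-sum G ⟩
  ∑[ x < suc n ] ∑[ y < suc n ] d x y                     ≡⟨ sum-remove {i = z} (λ x → ∑[ y < suc n ] d x y) ⟩
  ∑[ y < suc n ] d z y + ∑[ i < n ] ∑[ y < suc n ] d (punchIn z i) y
    ≡⟨ cong (∑[ y < suc n ] d z y +_) (sum-cong-≗ (λ i → sum-remove {i = z} (d (punchIn z i)))) ⟩
  ∑[ y < suc n ] d z y + ∑[ i < n ] (d (punchIn z i) z + ∑[ j < n ] d (punchIn z i) (punchIn z j))
    ≡⟨ cong (∑[ y < suc n ] d z y +_) (∑-distrib-+ (λ i → d (punchIn z i) z) _) ⟩
  ∑[ y < suc n ] d z y + (∑[ i < n ] d (punchIn z i) z + R) ≡⟨ +-assoc (∑[ y < suc n ] d z y) _ R ⟨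
  ∑[ y < suc n ] d z y + ∑[ i < n ] d (punchIn z i) z + R   ≡⟨ cong (λ t → ∑[ y < suc n ] d z y + t + R) into-z ⟨
  ∑[ y < suc n ] d z y + ∑[ y < suc n ] d y z + R         ≡⟨ cong (_+ R) (∑-distrib-+ (d z) (λ y → d y z)) ⟨
  contribution G z + R                                    ∎
  where
  open ≡-Reasoning
  d = dist G
  R = ∑[ i < n ] ∑[ j < n ] d (punchIn z i) (punchIn z j)
  into-z : ∑[ y < suc n ] d y z ≡ ∑[ i < n ] d (punchIn z i) z
  into-z = trans (sum-remove {i = z} (λ y → d y z)) (cong (_+ ∑[ i < n ] d (punchIn z i) z) (dist-self G z))

-- If G minus z is still strongly connected, its distances dominate those of G.
σ-delete : ∀ {n} (G : Digraph (suc n)) z → StronglyConnected (delete G z) → σ G ≤ contribution G z + σ (delete G z)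
σ-delete {n} G z sc′ = begin
  σ G                                                                  ≡⟨ σ-split G z ⟩
  contribution G z + ∑[ i < n ] ∑[ j < n ] dist G (punchIn z i) (punchIn z j)
    ≤⟨ +-monoʳ-≤ (contribution G z) (sum-mono (λ i → sum-mono (λ j → dist-≤ G (lift-walk (Distance.shortest (delete G z) sc′ i j))))) ⟩
  contribution G z + ∑[ i < n ] ∑[ j < n ] dist (delete G z) i j      ≡⟨ cong (contribution G z +_) (σ-as-sum (delete G z)) ⟨
  contribution G z + σ (delete G z)                                    ∎
  where open ≤-Reasoning

-- Deleting a vertex z farthest from some x, at distance at least 3, keeps a
-- strongly connected tournament strongly connected: shortest walks from x never
-- pass z, and walks into x can jump to x as soon as they are near x.
module FarthestDeletion {n : ℕ} (G : Digraph (suc n)) (tour : IsTournament G) (sc : StronglyConnected G)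
                        {x z : Fin (suc n)} (farthest : ∀ y → dist G x y ≤ dist G x z) (far : 3 ≤ dist G x z) where
  open TournamentDistance G tour sc

  G′ : Digraph n
  G′ = delete G z

  closer⇒≢ : ∀ {y} → d x y < d x z → z ≢ y
  closer⇒≢ lt refl = <-irrefl refl lt

  z≢x : z ≢ x
  z≢x = closer⇒≢ (subst (_< d x z) (sym (d-self x)) (≤-trans (s≤s z≤n) far))

  preimage : ∀ {v} → z ≢ v → ∃ λ i → punchIn z i ≡ v
  preimage z≢v = punchOut z≢v , punchIn-punchOut z≢v

  x′ : Fin n
  x′ = proj₁ (preimage z≢x)

  x′-spec : punchIn z x′ ≡ x
  x′-spec = proj₂ (preimage _)

  -- Shortest walks from x, which only visit vertices closer than z.
  from-x : ∀ k i → d x (punchIn z i) ≡ k → Walk G′ k x′ i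
  from-x zero    i e = subst (Walk G′ 0 x′) (punchIn-injective z x′ i (trans x′-spec (d≡0 e))) here
  from-x (suc k) i e =
    let u , a , e′ = last-step (subst (1 ≤_) (sym e) (s≤s z≤n))
        u′ , u′↦u  = preimage (closer⇒≢ (≤-trans (≤-reflexive e′) (farthest (punchIn z i))))
    in from-x k u′ (trans (cong (d x) u′↦u) (suc-injective (trans e′ e)))
       ▷ subst (λ v → Arrow G v (punchIn z i)) (sym u′↦u) a


  near : ∀ {v} → ¬ Arrow G v x → d x v ≤ 1
  near {v} ¬a with v ≟ x
  ... | yes refl = ≤-trans (≤-reflexive (d-self v)) z≤n
  ... | no  v≢x = ≤-reflexive (arrow⇒d≡1 (reverse v≢x ¬a))

  -- Any walk into x can be rerouted avoiding z: once the walk is at a vertex not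
  -- pointing to x, the next vertex is within distance 2 of x, so it is not z.
  to-x : ∀ {k v} → Walk G k v x → ∀ i → punchIn z i ≡ v → ∃ λ m → Walk G′ m i x′
  to-x here i i↦x = 0 , subst (Walk G′ 0 i) (punchIn-injective z i x′ (trans i↦x (sym x′-spec))) here
  to-x {v = v} (step a w) i i↦v with T? (G v x)
  ... | yes v→x = 1 , step (subst₂ (Arrow G) (sym i↦v) (sym x′-spec) v→x) here
  ... | no ¬v→x =
    let y′ , y′↦y = preimage (closer⇒≢ (≤-trans (s≤s (≤-trans (d-▷ a) (s≤s (near ¬v→x)))) far))
        m , w′ = to-x w y′ y′↦y
    in suc m , step (subst₂ (Arrow G) (sym i↦v) (sym y′↦y) a) w′

  strongly-connected : StronglyConnected G′
  strongly-connected i j =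
    let m , w = to-x (shortest (punchIn z i) x) i refl
    in m + d x (punchIn z j) , w ++ᵂ from-x (d x (punchIn z j)) j refl

two-choose-two : ∀ k → 2 * (suc k C 2) ≡ suc k * k
two-choose-two zero    = refl
two-choose-two (suc k) = begin
  2 * (suc (suc k) C 2)       ≡⟨ cong (2 *_) (nCk+nC[k+1]≡[n+1]C[k+1] (suc k) 1) ⟨
  2 * (suc k C 1 + suc k C 2) ≡⟨ cong (λ t → 2 * (t + suc k C 2)) (nC1≡n (suc k)) ⟩
  2 * (suc k + suc k C 2)     ≡⟨ *-distribˡ-+ 2 (suc k) _ ⟩
  2 * suc k + 2 * (suc k C 2) ≡⟨ cong (2 * suc k +_) (two-choose-two k) ⟩
  2 * suc k + suc k * k       ≡⟨ solve 1 (λ k → con 2 :* (con 1 :+ k) :+ (con 1 :+ k) :* k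
                                             := (con 2 :+ k) :* (con 1 :+ k)) refl k ⟩
  suc (suc k) * suc k         ∎
  where
  open ≡-Reasoning
  open +-*-Solver

bound-step : ∀ m → bound (suc (suc m)) ≡ bound (suc m) + suc (suc (suc m)) C 2
bound-step m = begin
  List.sum (map f (upTo (suc m)))          ≡⟨ cong (List.sum ∘ map f) (upTo-∷ʳ m) ⟨
  List.sum (map f (upTo m ∷ʳ m))           ≡⟨ cong List.sum (map-++ f (upTo m) (m ∷ [])) ⟩
  List.sum (map f (upTo m) ++ f m ∷ [])    ≡⟨ sum-++ (map f (upTo m)) (f m ∷ []) ⟩
  bound (suc m) + (f m + 0)                ≡⟨ cong (bound (suc m) +_) (+-identityʳ (f m)) ⟩
  bound (suc m) + f m                      ≡⟨ cong (λ t → bound (suc m) + t C 2) (+-comm (suc (suc m)) 1) ⟩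
  bound (suc m) + suc (suc (suc m)) C 2    ∎
  where
  open ≡-Reasoning
  f : ℕ → ℕ
  f i = (suc (suc i) + 1) C 2

two-bound-step : ∀ m → 2 * bound (suc (suc m)) ≡ suc (suc (suc m)) * suc (suc m) + 2 * bound (suc m)
two-bound-step m = begin
  2 * bound (suc (suc m))                           ≡⟨ cong (2 *_) (bound-step m) ⟩
  2 * (bound (suc m) + suc (suc (suc m)) C 2)       ≡⟨ *-distribˡ-+ 2 (bound (suc m)) _ ⟩
  2 * bound (suc m) + 2 * (suc (suc (suc m)) C 2)   ≡⟨ cong (2 * bound (suc m) +_) (two-choose-two (suc (suc m))) ⟩
  2 * bound (suc m) + suc (suc (suc m)) * suc (suc m) ≡⟨ +-comm (2 * bound (suc m)) _ ⟩
  suc (suc (suc m)) * suc (suc m) + 2 * bound (suc m) ∎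
  where open ≡-Reasoning

diameter-two-arith : ∀ k → 3 * (suc (suc (suc (suc k))) * suc (suc (suc k))) + 2 ≤ 2 * bound (suc (suc (suc (suc k))))
diameter-two-arith zero    = ≤-refl
diameter-two-arith (suc k) = begin
  3 * (suc N * N) + 2                             ≡⟨ solve 1 (λ k → con 3 :* ((con 5 :+ k) :* (con 4 :+ k)) :+ con 2
                                                               := (con 3 :* ((con 4 :+ k) :* (con 3 :+ k)) :+ con 2) :+ con 6 :* (con 4 :+ k)) refl k ⟩
  (3 * (N * pred N) + 2) + 6 * N                  ≤⟨ +-mono-≤ (diameter-two-arith k) (m≤m+n (6 * N) ((3 + k) * (2 + k))) ⟩
  2 * bound N + (6 * N + (3 + k) * (2 + k))       ≡⟨ cong (2 * bound N +_) (solve 1 (λ k → con 6 :* (con 4 :+ k) :+ (con 3 :+ k) :* (con 2 :+ k)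
                                                               := (con 6 :+ k) :* (con 5 :+ k)) refl k) ⟩
  2 * bound N + suc (suc N) * suc N               ≡⟨ +-comm (2 * bound N) _ ⟩
  suc (suc N) * suc N + 2 * bound N               ≡⟨ two-bound-step (suc (suc (suc k))) ⟨
  2 * bound (suc N)                               ∎
  where
  N = suc (suc (suc (suc k)))
  open ≤-Reasoning
  open +-*-Solver

σ-symmetric : ∀ {n} (G : Digraph n) → 2 * σ G ≡ ∑[ x < n ] ∑[ y < n ] (dist G x y + dist G y x)
σ-symmetric {n} G = begin
  2 * σ G                                                           ≡⟨ cong (σ G +_) (+-identityʳ (σ G)) ⟩
  σ G + σ G                                                         ≡⟨ cong₂ _+_ (σ-as-sum G) (trans (σ-as-sum G) (∑-comm (dist G))) ⟩
  ∑[ x < n ] ∑[ y < n ] dist G x y + ∑[ x < n ] ∑[ y < n ] dist G y x ≡⟨ ∑-distrib-+ (λ x → ∑[ y < n ] dist G x y) _ ⟨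
  ∑[ x < n ] (∑[ y < n ] dist G x y + ∑[ y < n ] dist G y x)        ≡⟨ sum-cong-≗ (λ x → ∑-distrib-+ (dist G x) (λ y → dist G y x)) ⟨
  ∑[ x < n ] ∑[ y < n ] (dist G x y + dist G y x)                    ∎
  where open ≡-Reasoning

-- If all distances are at most 2, each pair of vertices contributes at most 1 + 2.
σ-diameter-two : ∀ {n} (G : Digraph (suc n)) → IsTournament G → StronglyConnected G →
                 (∀ x y → dist G x y ≤ 2) → 2 * σ G ≤ 3 * (suc n * n)
σ-diameter-two {n} G tour sc small = begin
  2 * σ G                                         ≡⟨ σ-symmetric G ⟩
  ∑[ x < suc n ] ∑[ y < suc n ] (d x y + d y x)   ≤⟨ sum-mono row-bound ⟩
  ∑[ x < suc n ] (n * 3)                          ≡⟨ sum-const (suc n) (n * 3) ⟩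
  suc n * (n * 3)                                 ≡⟨ solve 2 (λ a b → a :* (b :* con 3) := con 3 :* (a :* b)) refl (suc n) n ⟩
  3 * (suc n * n)                                 ∎
  where
  open TournamentDistance G tour sc
  open ≤-Reasoning
  open +-*-Solver
  pair-bound : ∀ {x y} → x ≢ y → d x y + d y x ≤ 3
  pair-bound {x} {y} x≢y with pair x≢y
  ... | inj₁ e = subst (λ t → t + d y x ≤ 3) (sym e) (s≤s (small y x))
  ... | inj₂ e = subst (λ t → d x y + t ≤ 3) (sym e) (subst (_≤ 3) (+-comm 1 (d x y)) (s≤s (small x y)))
  row-bound : ∀ x → ∑[ y < suc n ] (d x y + d y x) ≤ n * 3
  row-bound x = begin
    ∑[ y < suc n ] (d x y + d y x)                          ≡⟨ sum-remove {i = x} (λ y → d x y + d y x) ⟩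
    d x x + d x x + ∑[ i < n ] (d x (punchIn x i) + d (punchIn x i) x)
      ≡⟨ cong (_+ ∑[ i < n ] (d x (punchIn x i) + d (punchIn x i) x)) (cong₂ _+_ (d-self x) (d-self x)) ⟩
    ∑[ i < n ] (d x (punchIn x i) + d (punchIn x i) x)      ≤⟨ sum-mono (λ i → pair-bound (punchInᵢ≢i x i ∘ sym)) ⟩
    ∑[ i < n ] 3                                            ≡⟨ sum-const n 3 ⟩
    n * 3                                                   ∎

record SigmaBound {N : ℕ} (G : Digraph N) : Set where
  field
    ≤-bound : σ G ≤ bound N
    <-bound : (∀ x y → dist G x y ≢ N ∸ 1) → σ G < bound N

-- Cancelling the factor 2 that keeps the arithmetic free of halves.
half-≤ : ∀ {a b} → 2 * a ≤ 2 * b → a ≤ b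
half-≤ = *-cancelˡ-≤ 2

half-< : ∀ {a b} → 2 * a + 2 ≤ 2 * b → a < b
half-< {a} {b} le = *-cancelˡ-≤ 2 (subst (_≤ 2 * b) (trans (+-comm (2 * a) 2) (sym (*-suc 2 a))) le)

diameter-two-bound : ∀ k (G : Digraph (3 + k)) → IsTournament G → StronglyConnected G →
                     (∀ x y → dist G x y ≤ 2) → SigmaBound G
diameter-two-bound zero G tour sc small = record
  { ≤-bound = half-≤ (σ-diameter-two G tour sc small)
  ; <-bound = λ no-distance-2 → ⊥-elim (distance-2 no-distance-2)
  }
  where
  open TournamentDistance G tour sc
  -- Of the two directions between the first two vertices, one is not an arrow.
  distance-2 : ¬ (∀ x y → d x y ≢ 2)
  distance-2 none with total zero (suc zero) (λ ())
  ... | inj₁ a = none (suc zero) zero (≤-antisym (small (suc zero) zero) (d-≥2 (λ ()) (antisym zero (suc zero) a)))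
  ... | inj₂ a = none zero (suc zero) (≤-antisym (small zero (suc zero)) (d-≥2 (λ ()) (antisym (suc zero) zero a)))
diameter-two-bound (suc k) G tour sc small = record { ≤-bound = <⇒≤ strict ; <-bound = λ _ → strict }
  where
  strict : σ G < bound (4 + k)
  strict = half-< (≤-trans (+-monoˡ-≤ 2 (σ-diameter-two G tour sc small)) (diameter-two-arith k))

argmax : ∀ {n} (f : Fin (suc n) → ℕ) → ∃ λ m → ∀ y → f y ≤ f m
argmax f with maximum (λ _ → true) f
... | inj₁ none = ⊥-elim (none zero tt)
... | inj₂ (m , _ , max) = m , λ y → max y tt

-- Tournaments of larger diameter: delete the vertex z farthest from an x that
-- has a vertex at distance at least 3, and use the bound for the contribution of z.
deletion-bound : ∀ k → (∀ (G′ : Digraph (3 + k)) → IsTournament G′ → StronglyConnected G′ → SigmaBound G′) →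
                 (G : Digraph (4 + k)) → IsTournament G → StronglyConnected G →
                 ∀ x y → 3 ≤ dist G x y → SigmaBound G
deletion-bound k bound-below G tour sc x y far = record
  { ≤-bound = half-≤ (begin
      2 * σ G                                ≤⟨ σ≤ ⟩
      2 * contribution G z + 2 * σ G′        ≤⟨ +-mono-≤ contribution-≤ (*-monoʳ-≤ 2 (SigmaBound.≤-bound smaller)) ⟩
      suc (suc N) * suc N + 2 * bound N      ≡⟨ two-bound-step (2 + k) ⟨
      2 * bound (suc N)                      ∎)
  ; <-bound = λ no-diameter → half-< (begin
      2 * σ G + 2                            ≤⟨ +-monoˡ-≤ 2 σ≤ ⟩
      2 * contribution G z + 2 * σ G′ + 2    ≡⟨ swap-last (2 * contribution G z) (2 * σ G′) 2 ⟩
      2 * contribution G z + 2 + 2 * σ G′    ≤⟨ +-mono-≤ (contribution-< (no-diameter z) (λ y → no-diameter y z))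
                                                          (*-monoʳ-≤ 2 (SigmaBound.≤-bound smaller)) ⟩
      suc (suc N) * suc N + 2 * bound N      ≡⟨ two-bound-step (2 + k) ⟨
      2 * bound (suc N)                      ∎)
  }
  where
  N = 3 + k
  open ≤-Reasoning
  z = proj₁ (argmax (dist G x))
  farthest : ∀ v → dist G x v ≤ dist G x z
  farthest = proj₂ (argmax (dist G x))
  z-far : 3 ≤ dist G x z
  z-far = ≤-trans far (farthest y)
  open FarthestDeletion G tour sc {x} {z} farthest z-far
  open Contribution G tour sc z
  open Bound x (z≢x ∘ sym)
  smaller = bound-below G′ (delete-tournament z tour) strongly-connected
  swap-last : ∀ a b c → a + b + c ≡ a + c + b
  swap-last a b c = trans (+-assoc a b c) (trans (cong (a +_) (+-comm b c)) (sym (+-assoc a c b)))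
  σ≤ : 2 * σ G ≤ 2 * contribution G z + 2 * σ G′
  σ≤ = ≤-trans (*-monoʳ-≤ 2 (σ-delete G z strongly-connected)) (≤-reflexive (*-distribˡ-+ 2 (contribution G z) (σ G′)))

upper-bound : ∀ k (G : Digraph (3 + k)) → IsTournament G → StronglyConnected G → SigmaBound G
upper-bound k G tour sc with any? (λ x → any? (λ y → 3 ≤? dist G x y))
... | no ¬far = diameter-two-bound k G tour sc (λ x y → ≤-pred (≰⇒> (λ 3≤d → ¬far (x , y , 3≤d))))
upper-bound zero    G tour sc | yes (x , y , far) = ⊥-elim (<⇒≱ (Distance.d<n G sc x y) far)
upper-bound (suc k) G tour sc | yes (x , y , far) = deletion-bound k (upper-bound k) G tour sc x y far

adjacent-positions : ∀ {k} (a b : Fin (suc k)) → toℕ b ≡ suc (toℕ a) → ∃ λ (i : Fin k) → inject₁ i ≡ a × suc i ≡ b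
adjacent-positions zero (suc zero) _ = zero , refl , refl
adjacent-positions {suc k} (suc a) (suc b) e with adjacent-positions a b (suc-injective e)
... | i , refl , refl = suc i , refl , refl

-- A tournament on k + 1 vertices with a walk of length k between two vertices that
-- have no shorter walk is the backward tournament, ordered along the walk: the walk
-- visits every vertex, and an arrow from one vertex back to a later vertex by two or
-- more positions would be a shortcut.
module ShortestHamiltonianWalk {k : ℕ} (G : Digraph (suc k)) (tour : IsTournament G) {x y : Fin (suc k)}
                               (w : Walk G k x y) (shortest : ∀ {m} → Walk G m x y → k ≤ m) where
  open IsTournament tour

  v : Fin (suc k) → Fin (suc k)
  v = vertex w

  v-injective : ∀ a b → v a ≡ v b → a ≡ b
  v-injective a b eq with <-cmp (toℕ a) (toℕ b)
  ... | tri< a<b _ _ = let _ , m<k , w′ = remove-cycle w a b a<b eq in ⊥-elim (<⇒≱ m<k (shortest w′))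
  ... | tri≈ _ a≡b _ = toℕ-injective a≡b
  ... | tri> _ _ b<a = let _ , m<k , w′ = remove-cycle w b a b<a (sym eq) in ⊥-elim (<⇒≱ m<k (shortest w′))

  -- An injective map of Fin (k + 1) into itself is onto.
  v-surjective : ∀ u → ∃ λ a → v a ≡ u
  v-surjective u with any? (λ a → v a ≟ u)
  ... | yes hit = hit
  ... | no miss = ⊥-elim (<-irrefl refl (injective⇒≤ {f = λ a → punchOut (avoid a)} squeezed))
    where
    avoid : ∀ a → u ≢ v a
    avoid a eq = miss (a , sym eq)
    squeezed : ∀ {a b} → punchOut (avoid a) ≡ punchOut (avoid b) → a ≡ b
    squeezed {a} {b} eq = v-injective a b (punchOut-injective (avoid a) (avoid b) eq)

  position : Fin (suc k) → Fin (suc k)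
  position u = proj₁ (v-surjective u)

  position-spec : ∀ u → v (position u) ≡ u
  position-spec u = proj₂ (v-surjective u)

  ordering : Fin (suc k) ↔ Fin (suc k)
  ordering = mk↔ₛ′ position v (λ a → v-injective _ _ (position-spec (v a))) position-spec

  forward-arrow : ∀ a b → toℕ b ≡ suc (toℕ a) → Arrow G (v a) (v b)
  forward-arrow a b e with adjacent-positions a b e
  ... | i , refl , refl = vertex-arrow w i

  backward-arrow : ∀ a b → suc (suc (toℕ b)) ≤ toℕ a → Arrow G (v a) (v b)
  backward-arrow a b b+2≤a with T? (G (v a) (v b))
  ... | yes a→b = a→b
  ... | no ¬a→b = ⊥-elim (<⇒≱ (shortcut-shorter 1 b a (subst (λ t → suc t ≤ toℕ a) (+-comm 1 (toℕ b)) b+2≤a))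
                                (shortest (shortcut w b a (step (reverse ¬a→b) here))))
    where
    reverse : ¬ Arrow G (v a) (v b) → Arrow G (v b) (v a)
    reverse ¬a with total (v a) (v b) (λ eq → <-irrefl (cong toℕ (sym (v-injective a b eq))) (≤-trans (n≤1+n _) b+2≤a))
    ... | inj₁ a→b = ⊥-elim (¬a a→b)
    ... | inj₂ b→a = b→a

  arrows : ∀ a b → G (v a) (v b) ≡ backward (suc k) a b
  arrows a b with toℕ b ℕ.≟ suc (toℕ a)
  ... | yes b≡a+1 = T⇒≡true (forward-arrow a b b≡a+1)
  ... | no  b≢a+1 with suc (suc (toℕ b)) ℕ.≤? toℕ a
  ...   | yes b+2≤a = T⇒≡true (backward-arrow a b b+2≤a)
  ...   | no  b+2≰a with <-cmp (toℕ a) (toℕ b)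
  ...     | tri≈ _ a≡b _ rewrite toℕ-injective {i = a} {j = b} a≡b = ¬T⇒≡false (irrefl (v b))
  ...     | tri< a<b _ _ = ¬T⇒≡false (antisym (v b) (v a) (backward-arrow b a (≤∧≢⇒< a<b (b≢a+1 ∘ sym))))
  ...     | tri> _ _ b<a with m≤n⇒m<n∨m≡n b<a
  ...       | inj₁ b+1<a  = ⊥-elim (b+2≰a b+1<a)
  ...       | inj₂ b+1≡a  = ¬T⇒≡false (antisym (v b) (v a) (forward-arrow b a (sym b+1≡a)))

  isomorphism : Iso G (backward (suc k))
  isomorphism = ordering , λ i j → trans (cong₂ G (sym (position-spec i)) (sym (position-spec j))) (arrows (position i) (position j))

-- Lower bounds for distances in the backward tournament, by positions a, b:
-- arrows advance at most one position, and position a + 1 has no arrow to a.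
L : ℕ → ℕ → ℕ
L zero          b       = b
L (suc a)       (suc b) = L a b
L (suc zero)    zero    = 2
L (suc (suc a)) zero    = 1

L-≤ : ∀ a b D → b ∸ a ≤ D → (a ≢ b → 1 ≤ D) → (a ≡ suc b → 2 ≤ D) → L a b ≤ D
L-≤ zero          b       D advance _        _    = advance
L-≤ (suc a)       (suc b) D advance distinct back = L-≤ a b D advance (λ a≢b → distinct (a≢b ∘ suc-injective)) (back ∘ cong suc)
L-≤ (suc zero)    zero    D _       _        back = back refl
L-≤ (suc (suc a)) zero    D _       distinct _    = distinct (λ ())

sum-toℕ : ∀ k → ∑[ b < suc k ] toℕ b ≡ suc k C 2
sum-toℕ zero    = refl
sum-toℕ (suc k) = begin
  ∑[ b < suc k ] suc (toℕ b)             ≡⟨ ∑-distrib-+ {suc k} (λ _ → 1) toℕ ⟩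
  ∑[ b < suc k ] 1 + ∑[ b < suc k ] toℕ b ≡⟨ cong₂ _+_ (trans (sum-const (suc k) 1) (*-identityʳ (suc k))) (sum-toℕ k) ⟩
  suc k + suc k C 2                      ≡⟨ cong (_+ suc k C 2) (nC1≡n (suc k)) ⟨
  suc k C 1 + suc k C 2                  ≡⟨ nCk+nC[k+1]≡[n+1]C[k+1] (suc k) 1 ⟩
  suc (suc k) C 2                        ∎
  where open ≡-Reasoning

L-total : ℕ → ℕ
L-total m = ∑[ a < m ] ∑[ b < m ] L (toℕ a) (toℕ b)

-- Position 0 contributes its row, the other rows start with their entry at column 0.
L-total-step : ∀ m → L-total (suc (suc m)) ≡ L-total (suc m) + suc (suc (suc m)) C 2
L-total-step m = begin
  ∑[ b < suc (suc m) ] toℕ b + ∑[ a < suc m ] (L (suc (toℕ a)) 0 + ∑[ b < suc m ] L (toℕ a) (toℕ b))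
    ≡⟨ cong (∑[ b < suc (suc m) ] toℕ b +_) (∑-distrib-+ {suc m} (λ a → L (suc (toℕ a)) 0) (λ a → ∑[ b < suc m ] L (toℕ a) (toℕ b))) ⟩
  ∑[ b < suc (suc m) ] toℕ b + (2 + ∑[ a < m ] 1 + L-total (suc m))
    ≡⟨ cong₂ (λ s t → s + (2 + t + L-total (suc m))) (sum-toℕ (suc m)) (trans (sum-const m 1) (*-identityʳ m)) ⟩
  suc (suc m) C 2 + (suc (suc m) + L-total (suc m))
    ≡⟨ solve 3 (λ c s t → c :+ (s :+ t) := t :+ (s :+ c)) refl (suc (suc m) C 2) (suc (suc m)) (L-total (suc m)) ⟩
  L-total (suc m) + (suc (suc m) + suc (suc m) C 2)
    ≡⟨ cong (λ s → L-total (suc m) + (s + suc (suc m) C 2)) (nC1≡n (suc (suc m))) ⟨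
  L-total (suc m) + (suc (suc m) C 1 + suc (suc m) C 2)
    ≡⟨ cong (L-total (suc m) +_) (nCk+nC[k+1]≡[n+1]C[k+1] (suc (suc m)) 1) ⟩
  L-total (suc m) + suc (suc (suc m)) C 2 ∎
  where
  open ≡-Reasoning
  open +-*-Solver

L-total≡bound : ∀ m → L-total (suc m) ≡ bound (suc m)
L-total≡bound zero    = refl
L-total≡bound (suc m) = trans (L-total-step m) (trans (cong (_+ suc (suc (suc m)) C 2) (L-total≡bound m)) (sym (bound-step m)))

module BackwardLowerBound {m : ℕ} (G : Digraph (suc m)) (sc : StronglyConnected G) (f : Fin (suc m) ↔ Fin (suc m))
                          (preserves : ∀ i j → G i j ≡ backward (suc m) (Inverse.to f i) (Inverse.to f j)) where
  open Distance G sc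

  pos : Fin (suc m) → ℕ
  pos x = toℕ (Inverse.to f x)

  arrow-cases : ∀ {x y} → Arrow G x y → pos y ≡ suc (pos x) ⊎ suc (suc (pos y)) ≤ pos x
  arrow-cases {x} {y} a with Equivalence.to (T-∨ {⌊ pos y ℕ.≟ suc (pos x) ⌋} {⌊ suc (suc (pos y)) ℕ.≤? pos x ⌋})
                                             (subst T (preserves x y) a)
  ... | inj₁ forward = inj₁ (toWitness forward)
  ... | inj₂ back    = inj₂ (toWitness back)

  arrow-advance : ∀ {x y} → Arrow G x y → pos y ≤ suc (pos x)
  arrow-advance a with arrow-cases a
  ... | inj₁ forward = ≤-reflexive forward
  ... | inj₂ back    = ≤-trans (n≤1+n _) (≤-trans (n≤1+n _) (≤-trans back (n≤1+n _)))

  walk-advance : ∀ {k x y} → Walk G k x y → pos y ≤ pos x + k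
  walk-advance {x = x} here = m≤m+n (pos x) 0
  walk-advance {suc k} {x} (step a w) = begin
    pos _           ≤⟨ walk-advance w ⟩
    pos _ + k       ≤⟨ +-monoˡ-≤ k (arrow-advance a) ⟩
    suc (pos x) + k ≡⟨ +-suc (pos x) k ⟨
    pos x + suc k   ∎
    where open ≤-Reasoning

  no-step-back : ∀ {x y} → pos x ≡ suc (pos y) → ¬ Arrow G x y
  no-step-back {x} {y} e a with arrow-cases a
  ... | inj₁ forward = <-irrefl (trans forward (cong suc e)) (m<n⇒m<1+n (n<1+n (pos y)))
  ... | inj₂ back    = <-irrefl refl (≤-trans back (≤-reflexive e))

  distance-lower : ∀ x y → L (pos x) (pos y) ≤ d x y
  distance-lower x y = L-≤ (pos x) (pos y) (d x y) (m≤n+o⇒m∸n≤o (pos y) (pos x) (walk-advance (shortest x y)))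
    (λ ≢ → d-positive (≢ ∘ cong pos))
    (λ e → d-≥2 (λ x≡y → 1+n≢n (trans (sym e) (cong pos x≡y))) (no-step-back e))

  σ-lower : bound (suc m) ≤ σ G
  σ-lower = begin
    bound (suc m)                                          ≡⟨ L-total≡bound m ⟨
    ∑[ a < suc m ] ∑[ b < suc m ] L (toℕ a) (toℕ b)          ≡⟨ sum-permute (λ a → ∑[ b < suc m ] L (toℕ a) (toℕ b)) f ⟩
    ∑[ x < suc m ] ∑[ b < suc m ] L (pos x) (toℕ b)          ≡⟨ sum-cong-≗ (λ x → sum-permute (λ b → L (pos x) (toℕ b)) f) ⟩
    ∑[ x < suc m ] ∑[ y < suc m ] L (pos x) (pos y)          ≤⟨ sum-mono (λ x → sum-mono (distance-lower x)) ⟩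
    ∑[ x < suc m ] ∑[ y < suc m ] d x y                      ≡⟨ σ-as-sum G ⟨
    σ G                                                    ∎
    where open ≤-Reasoning

lemma1 : (n : ℕ) → 3 ≤ n → (T : Digraph n) → IsTournament T → StronglyConnected T →
           (σ T ≤ bound n) × (σ T ≡ bound n ⇔ Iso T (backward n))
lemma1 (suc zero)       (s≤s ())
lemma1 (suc (suc zero)) (s≤s (s≤s ()))
lemma1 (suc (suc (suc k))) _ G tour sc = ≤-bound , mk⇔ extremal⇒backward backward⇒extremal
  where
  open SigmaBound (upper-bound k G tour sc)
  open Distance G sc
  -- Equality forces two vertices at distance n − 1, joined by a shortest Hamiltonian walk.
  extremal⇒backward : σ G ≡ bound (3 + k) → Iso G (backward (3 + k))
  extremal⇒backward σ≡bound with any? (λ x → any? (λ y → d x y ℕ.≟ suc (suc k)))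
  ... | yes (x , y , d≡) = ShortestHamiltonianWalk.isomorphism G tour
                             (subst (λ j → Walk G j x y) d≡ (shortest x y)) (λ w → subst (_≤ _) d≡ (dist-≤ G w))
  ... | no  none         = ⊥-elim (<-irrefl σ≡bound (<-bound (λ x y d≡ → none (x , y , d≡))))
  backward⇒extremal : Iso G (backward (3 + k)) → σ G ≡ bound (3 + k)
  backward⇒extremal (f , preserves) = ≤-antisym ≤-bound (BackwardLowerBound.σ-lower G sc f preserves)
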